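{- Let $\Sigma_{\mathrm U}=\Sigma_{\mathrm{UFD}}\cup\Sigma_{\mathrm{UID}}$ be a set of unary FDs and UIDs closed under finite implication. Then the SCC graph $G(\Sigma_{\mathrm{UID}})$ has an inverse-sequential topological sort.
   Context: A UID $R^p\subseteq S^q$ ($R^p\ne S^q$) says every element at $R^p$ occurs at $S^q$; its reverse $\tau^{ -1}$ is $S^q\subseteq R^p$. A unary FD $R^i\to R^j$ says two $R$-facts agreeing on $R^i$ agree on $R^j$. Closed under finite implication: contains every UID and UFD satisfied by all finite instances satisfying $\Sigma_{\mathrm U}$. For $\tau:R^p\subseteq S^q$, $\tau':S^r\subseteq T^u$ in $\Sigma_{\mathrm{UID}}$, $\tau\rightarrowtail\tau'$ iff $S^r\neq S^q$ and $S^r\to S^q\in\Sigma_{\mathrm{UFD}}$. $\Gamma(\Sigma_{\mathrm{UID}})$ is the directed graph on $\Sigma_{\mathrm{UID}}$ with edges $\rightarrowtail$; its SCCs are maximal sets $P$ with $\tau\rightarrowtail^*\tau'$ for all $\tau,\tau'\in P$. An SCC is trivial if it is a singleton $\{\tau\}$ with $\tau\not\rightarrowtail\tau$, non-trivial otherwise. For a non-trivial SCC $P$, $P^{ -1}=\{\tau^{ -1}:\tau\in P\}$ is also an SCC; $P$ is non-self-inverse if $P\neq P^{ -1}$. The SCC graph $G(\Sigma_{\mathrm{UID}})$ is the DAG on the SCCs with an edge from $P$ to $P'\neq P$ iff $\tau\rightarrowtail\tau'$ for some $\tau\in P$, $\tau'\in P'$. A topological sort is an enumeration of all SCCs in which $P$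 precedes $P'$ whenever there is an edge from $P$ to $P'$; it is inverse-sequential if for every non-self-inverse SCC $P$, $P$ and $P^{ -1}$ are enumerated consecutively. -}

module Defs where

open import Level using (0ℓ)
open import Data.Nat using (ℕ; suc; _<_)
open import Data.Fin using (Fin; toℕ)
open import Data.Vec using (Vec; lookup)
open import Data.List using (List)
open import Data.List.Membership.Propositional using (_∈_)
open import Data.List.Relation.Unary.All using (All)
open import Data.List.Relation.Unary.Any using (Any)
open import Data.Product using (Σ; ∃; _×_; _,_; proj₁; proj₂)
open import Data.Sum using (_⊎_)
open import Relation.Nullary using (¬_)
open import Relation.Unary using (Pred; _≐_; _⊆_)
open import Relation.Binary.PropositionalEquality using (_≡_; _≢_)
open import Relation.Binary.Construct.Closure.ReflexiveTransitive using (Star)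

record Schema : Set where
  field
    nRel  : ℕ
    arity : Fin nRel → ℕ
open Schema public

Pos : Schema → Set
Pos sch = Σ (Fin (nRel sch)) (λ R → Fin (arity sch R))

Instance : Schema → Set
Instance sch = (R : Fin (nRel sch)) → List (Vec ℕ (arity sch R))

OccursAt : {sch : Schema} → Instance sch → ℕ → Pos sch → Set
OccursAt I a (R , p) = ∃ λ t → t ∈ I R × lookup t p ≡ a

-- A UID R^p ⊆ S^q is a pair of positions (source, target);
-- the requirement R^p ≠ S^q is imposed separately (NonTrivialUID).
record UID (sch : Schema) : Set where
  constructor _⊆ᵘ_
  field
    src : Pos sch
    tgt : Pos sch
open UID public

NonTrivialUID : {sch : Schema} → UID sch → Set
NonTrivialUID τ = src τ ≢ tgt τ

_⁻¹ᵘ : {sch : Schema} → UID sch → UID sch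
(a ⊆ᵘ b) ⁻¹ᵘ = b ⊆ᵘ a

record UFD (sch : Schema) : Set where
  constructor ufd
  field
    rel : Fin (nRel sch)
    lhs : Fin (arity sch rel)
    rhs : Fin (arity sch rel)
open UFD public

SatUID : {sch : Schema} → Instance sch → UID sch → Set
SatUID I τ = ∀ a → OccursAt I a (src τ) → OccursAt I a (tgt τ)

SatUFD : {sch : Schema} → Instance sch → UFD sch → Set
SatUFD I (ufd R i j) =
  ∀ t t' → t ∈ I R → t' ∈ I R → lookup t i ≡ lookup t' i → lookup t j ≡ lookup t' j

SatAll : {sch : Schema} → Instance sch → List (UFD sch) → List (UID sch) → Set
SatAll I ΣUFD ΣUID = All (SatUFD I) ΣUFD × All (SatUID I) ΣUID

FinImpliesUID : {sch : Schema} → List (UFD sch) → List (UID sch) → UID sch → Set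
FinImpliesUID {sch} ΣUFD ΣUID τ = (I : Instance sch) → SatAll I ΣUFD ΣUID → SatUID I τ

FinImpliesUFD : {sch : Schema} → List (UFD sch) → List (UID sch) → UFD sch → Set
FinImpliesUFD {sch} ΣUFD ΣUID φ = (I : Instance sch) → SatAll I ΣUFD ΣUID → SatUFD I φ

ClosedUnderFinImp : {sch : Schema} → List (UFD sch) → List (UID sch) → Set
ClosedUnderFinImp {sch} ΣUFD ΣUID =
  ((τ : UID sch) → NonTrivialUID τ → FinImpliesUID ΣUFD ΣUID τ → τ ∈ ΣUID)
  × ((φ : UFD sch) → FinImpliesUFD ΣUFD ΣUID φ → φ ∈ ΣUFD)

module _ {sch : Schema} (ΣUFD : List (UFD sch)) (ΣUID : List (UID sch)) where

  UFDIn : Pos sch → Pos sch → Set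
  UFDIn a b = Any (λ φ → (rel φ , lhs φ) ≡ a × (rel φ , rhs φ) ≡ b) ΣUFD

  -- τ ↣ τ' for τ : R^p ⊆ S^q, τ' : S'^r ⊆ T^u (both in Σ_UID):
  -- S^r ≠ S^q and S^r → S^q ∈ Σ_UFD (which forces S' = S)
  Edge : UID sch → UID sch → Set
  Edge τ τ' = τ ∈ ΣUID × τ' ∈ ΣUID × src τ' ≢ tgt τ × UFDIn (src τ') (tgt τ)

  Reach : UID sch → UID sch → Set
  Reach = Star Edge

  UIDSet : Set₁
  UIDSet = Pred (UID sch) 0ℓ

  StronglyConnected : UIDSet → Set
  StronglyConnected P =
    (P ⊆ (_∈ ΣUID)) × (∀ {τ τ'} → P τ → P τ' → Reach τ τ')

  IsSCC : UIDSet → Set₁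
  IsSCC P = StronglyConnected P × (∃ λ τ → P τ)
          × ((Q : UIDSet) → StronglyConnected Q → P ⊆ Q → Q ⊆ P)

  Singleton : UID sch → UIDSet
  Singleton τ = λ τ' → τ' ≡ τ

  TrivialSCC : UIDSet → Set
  TrivialSCC P = ∃ λ τ → (P ≐ Singleton τ) × ¬ Edge τ τ

  InverseSet : UIDSet → UIDSet
  InverseSet P = λ τ → P (τ ⁻¹ᵘ)

  NonSelfInverse : UIDSet → Set
  NonSelfInverse P = ¬ TrivialSCC P × ¬ (P ≐ InverseSet P)

  SCCEdge : UIDSet → UIDSet → Set
  SCCEdge P P' = ¬ (P ≐ P') × ∃ λ τ → ∃ λ τ' → P τ × P' τ' × Edge τ τ'

  record TopologicalSort : Set₁ where
    field
      n        : ℕ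
      L        : Fin n → UIDSet
      isSCC    : ∀ i → IsSCC (L i)
      complete : (P : UIDSet) → IsSCC P → ∃ λ i → L i ≐ P
      distinct : ∀ i j → L i ≐ L j → i ≡ j
      ordered  : ∀ i j → SCCEdge (L i) (L j) → toℕ i < toℕ j

  InverseSequential : TopologicalSort → Set
  InverseSequential ts =
    ∀ i → NonSelfInverse (L i) →
      ∃ λ j → (toℕ j ≡ suc (toℕ i) ⊎ toℕ i ≡ suc (toℕ j)) × (L j ≐ InverseSet (L i))
    where open TopologicalSort ts

-- Let |x| be the number of distinct elements at position x of a finite model.
-- A UID a ⊆ b gives |a| ≤ |b|, a UFD a → b gives |b| ≤ |a|, and closure under finite
-- implication reverses any dependency whose two sides have provably equal
-- cardinalities (Cardinality, Implication).  Along every cycle of Γ all cardinalities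
-- are equal, so cyclic paths can be reversed UID by UID (Graph).  The central fact
-- (SelfInverse) is that a non-trivial SCC reaching its inverse is self-inverse; it is
-- proved by a pigeonhole argument on the sources and targets of an SCC.  Merging each
-- non-trivial SCC P with P⁻¹ then yields an acyclic quotient (Merged, H-cycle).
-- Finally, each UID gets a numeric key (Keys) ordering first the merged classes
-- topologically, then the SCCs inside a class; enumerating SCCs by increasing key is
-- a topological sort in which P and P⁻¹ are adjacent (Enumeration).

module Submission where

open import Defs
open import Level using (0ℓ)
open import Function using (_∘_; id)
open import Data.Nat using (ℕ; suc; _≤_; _<_; z≤n; s≤s; _+_; _*_)
import Data.Nat as ℕ
open import Data.Nat.Properties
  using ( _≟_; ≤-refl; ≤-trans; ≤-antisym; <-trans; <-irrefl; <-asym; <-cmp; ≤∧≢⇒<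
        ; m≤n⇒m≤1+n; m<n⇒m<1+n; m≤m+n; 0≢1+n; suc-injective; +-comm; +-cancelˡ-≡
        ; +-monoʳ-<; *-monoˡ-≤; module ≤-Reasoning )
open import Data.Fin using (Fin; toℕ; fromℕ<) renaming (zero to fzero; suc to fsuc)
import Data.Fin.Properties as Fin
import Data.Vec as Vec
open import Data.List using (List; []; _∷_; length; lookup; map; filter; deduplicate; upTo)
open import Data.List.Properties using (filter-notAll)
open import Data.List.Extrema.Nat using (max; xs≤max)
open import Data.List.Membership.Propositional using (_∈_; find; lose)
open import Data.List.Membership.Propositional.Properties
  using ( ∈-map⁺; ∈-map⁻; ∈-filter⁺; ∈-filter⁻; ∈-deduplicate⁺; ∈-deduplicate⁻
        ; ∈-upTo⁺; ∈-lookup )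
import Data.List.Membership.DecPropositional as DecMembership
open import Data.List.Relation.Unary.Any as Any using (Any; here; there; any?; index)
open import Data.List.Relation.Unary.Any.Properties using (lookup-index)
open import Data.List.Relation.Unary.All as All using (All)
open import Data.List.Relation.Unary.All.Properties using (¬Any⇒All¬)
open import Data.List.Relation.Unary.AllPairs using (AllPairs; []; _∷_)
import Data.List.Relation.Unary.AllPairs.Properties as AllPairs
open import Data.List.Relation.Unary.Unique.Propositional using (Unique)
import Data.List.Relation.Unary.Unique.Propositional.Properties as Unique
open import Data.List.Relation.Unary.Unique.DecPropositional.Properties using (deduplicate-!)
open import Data.Product using (Σ; ∃; ∃₂; _×_; _,_; proj₁; proj₂; uncurry)
import Data.Product.Properties as Product
open import Data.Sum using (_⊎_; inj₁; inj₂)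
open import Data.Empty using (⊥; ⊥-elim)
open import Relation.Nullary using (¬_; Dec; yes; no; ¬?)
open import Relation.Nullary.Decidable using (_⊎-dec_; _×-dec_)
open import Relation.Unary using (Pred; Decidable; _≐_)
open import Relation.Binary.Definitions using (DecidableEquality; tri<; tri≈; tri>)
open import Relation.Binary.PropositionalEquality
  using (_≡_; _≢_; refl; sym; trans; cong; cong₂; subst; subst₂)
open import Relation.Binary.Construct.Closure.ReflexiveTransitive using (Star; ε; _◅_; _◅◅_)

module Counting {A : Set} where

  count : {P : Pred A 0ℓ} → Decidable P → List A → ℕ
  count P? [] = 0
  count P? (x ∷ xs) with P? x
  ... | yes _ = suc (count P? xs)
  ... | no _ = count P? xs

  count-mono : {P Q : Pred A 0ℓ} (P? : Decidable P) (Q? : Decidable Q) (xs : List A) →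
    (∀ {x} → x ∈ xs → P x → Q x) → count P? xs ≤ count Q? xs
  count-mono P? Q? [] P⇒Q = z≤n
  count-mono P? Q? (x ∷ xs) P⇒Q with P? x | Q? x | count-mono P? Q? xs (P⇒Q ∘ there)
  ... | yes p | yes _ | ih = s≤s ih
  ... | yes p | no ¬q | ih = ⊥-elim (¬q (P⇒Q (here refl) p))
  ... | no _  | yes _ | ih = m≤n⇒m≤1+n ih
  ... | no _  | no _  | ih = ih

  count-strict : {P Q : Pred A 0ℓ} (P? : Decidable P) (Q? : Decidable Q) (xs : List A) →
    (∀ {x} → x ∈ xs → P x → Q x) → ∀ {y} → y ∈ xs → Q y → ¬ P y → count P? xs < count Q? xs
  count-strict P? Q? (x ∷ xs) P⇒Q (here refl) qy ¬py with P? x | Q? x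
  ... | yes p | _     = ⊥-elim (¬py p)
  ... | no _  | no ¬q = ⊥-elim (¬q qy)
  ... | no _  | yes _ = s≤s (count-mono P? Q? xs (P⇒Q ∘ there))
  count-strict P? Q? (x ∷ xs) P⇒Q (there y∈) qy ¬py
    with P? x | Q? x | count-strict P? Q? xs (P⇒Q ∘ there) y∈ qy ¬py
  ... | yes p | yes _ | ih = s≤s ih
  ... | yes p | no ¬q | ih = ⊥-elim (¬q (P⇒Q (here refl) p))
  ... | no _  | yes _ | ih = m<n⇒m<1+n ih
  ... | no _  | no _  | ih = ih

  firstIndex : {P : Pred A 0ℓ} → Decidable P → List A → ℕ
  firstIndex P? [] = 0
  firstIndex P? (x ∷ xs) with P? x
  ... | yes _ = 0
  ... | no _ = suc (firstIndex P? xs)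

  firstIndex-< : {P : Pred A 0ℓ} (P? : Decidable P) (xs : List A) → Any P xs →
    firstIndex P? xs < length xs
  firstIndex-< P? (x ∷ xs) px with P? x
  firstIndex-< P? (x ∷ xs) _          | yes _ = s≤s z≤n
  firstIndex-< P? (x ∷ xs) (here p)   | no ¬p = ⊥-elim (¬p p)
  firstIndex-< P? (x ∷ xs) (there px) | no _  = s≤s (firstIndex-< P? xs px)

  firstIndex-cong : {P Q : Pred A 0ℓ} (P? : Decidable P) (Q? : Decidable Q) (xs : List A) →
    (∀ {x} → x ∈ xs → P x → Q x) → (∀ {x} → x ∈ xs → Q x → P x) →
    firstIndex P? xs ≡ firstIndex Q? xs
  firstIndex-cong P? Q? [] P⇒Q Q⇒P = refl
  firstIndex-cong P? Q? (x ∷ xs) P⇒Q Q⇒P with P? x | Q? x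
  ... | yes _ | yes _ = refl
  ... | yes p | no ¬q = ⊥-elim (¬q (P⇒Q (here refl) p))
  ... | no ¬p | yes q = ⊥-elim (¬p (Q⇒P (here refl) q))
  ... | no _  | no _  = cong suc (firstIndex-cong P? Q? xs (P⇒Q ∘ there) (Q⇒P ∘ there))

  firstIndex-common : {P Q : Pred A 0ℓ} (P? : Decidable P) (Q? : Decidable Q) (xs : List A) →
    Any P xs → Any Q xs → firstIndex P? xs ≡ firstIndex Q? xs → ∃ λ z → P z × Q z
  firstIndex-common P? Q? (x ∷ xs) px qx same with P? x | Q? x
  ... | yes p | yes q = x , p , q
  ... | yes _ | no _  = ⊥-elim (0≢1+n same)
  ... | no _  | yes _ = ⊥-elim (0≢1+n (sym same))
  firstIndex-common P? Q? (x ∷ xs) (here p) _ _ | no ¬p | no _ = ⊥-elim (¬p p)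
  firstIndex-common P? Q? (x ∷ xs) (there _) (here q) _ | no _ | no ¬q = ⊥-elim (¬q q)
  firstIndex-common P? Q? (x ∷ xs) (there px) (there qx) same | no _ | no _ =
    firstIndex-common P? Q? xs px qx (suc-injective same)

module Pigeonhole {B : Set} (_≟_ : DecidableEquality B) where

  Total : {A : Set} → (A → B → Set) → List A → List B → Set
  Total R xs ys = ∀ {x} → x ∈ xs → ∃ λ y → y ∈ ys × R x y

  Injective : {A : Set} → (A → B → Set) → List A → Set
  Injective R xs = ∀ {x x′ y} → x ∈ xs → x′ ∈ xs → R x y → R x′ y → x ≡ x′

  private
    without : B → List B → List B
    without y = filter (λ z → ¬? (z ≟ y))

    without-unique : ∀ {y ys} → Unique ys → Unique (without y ys)
    without-unique = Unique.filter⁺ (λ z → ¬? (z ≟ _))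

    ∈-without : ∀ {y z ys} → z ∈ ys → z ≢ y → z ∈ without y ys
    ∈-without = ∈-filter⁺ (λ z → ¬? (z ≟ _))

    without-< : ∀ {y ys} → y ∈ ys → length (without y ys) < length ys
    without-< {y} {ys} y∈ys =
      filter-notAll (λ z → ¬? (z ≟ y)) ys (Any.map (λ y≡z z≢y → z≢y (sym y≡z)) y∈ys)

  injection-≤ : {A : Set} (R : A → B → Set) {xs : List A} {ys : List B} → Unique xs → Unique ys →
    Total R xs ys → Injective R xs → length xs ≤ length ys
  injection-≤ R {[]} _ _ _ _ = z≤n
  injection-≤ R {x ∷ xs} {ys} (x∉xs ∷ uxs) uys tot inj with tot (here refl)
  ... | y , y∈ys , rxy =
    ≤-trans (s≤s (injection-≤ R uxs (without-unique uys) tot′ (λ i i′ → inj (there i) (there i′))))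
            (without-< y∈ys)
    where
    tot′ : Total R xs (without y ys)
    tot′ x′∈ with tot (there x′∈)
    ... | y′ , y′∈ , rx′y′ =
      y′ , ∈-without y′∈ (λ { refl → All.lookup x∉xs x′∈ (inj (here refl) (there x′∈) rxy rx′y′) }) , rx′y′

  injection-< : {A : Set} (R : A → B → Set) {xs : List A} {ys : List B} → Unique xs → Unique ys →
    Total R xs ys → Injective R xs →
    ∀ {x₀ y₁ y₂} → x₀ ∈ xs → y₁ ∈ ys → y₂ ∈ ys → y₁ ≢ y₂ → R x₀ y₁ → R x₀ y₂ →
    length xs < length ys
  injection-< {A} R {xs} {ys} uxs uys tot inj {x₀} {y₁} {y₂} x₀∈ y₁∈ y₂∈ y₁≢y₂ r₁ r₂ =
    ≤-trans (s≤s (injection-≤ R′ uxs (without-unique uys) tot′ inj′)) (without-< y₂∈)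
    where
    R′ : A → B → Set
    R′ a b = R a b × b ≢ y₂
    tot′ : Total R′ xs (without y₂ ys)
    tot′ x∈ with tot x∈
    ... | y , y∈ , r with y ≟ y₂
    ...   | no y≢y₂ = y , ∈-without y∈ y≢y₂ , r , y≢y₂
    ...   | yes refl with inj x∈ x₀∈ r r₂
    ...     | refl = y₁ , ∈-without y₁∈ y₁≢y₂ , r₁ , y₁≢y₂
    inj′ : Injective R′ xs
    inj′ i i′ (r , _) (r′ , _) = inj i i′ r r′

module Increasing {xs : List ℕ} (inc : AllPairs _<_ xs) where

  lookup-< : ∀ i j → toℕ i < toℕ j → lookup xs i < lookup xs j
  lookup-< = go inc
    where
    go : ∀ {ys} → AllPairs _<_ ys → ∀ i j → toℕ i < toℕ j → lookup ys i < lookup ys j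
    go (y<ys ∷ _) fzero (fsuc j) _ = All.lookup y<ys (∈-lookup j)
    go (_ ∷ ys<) (fsuc i) (fsuc j) (s≤s i<j) = go ys< i j i<j

  lookup-<⁻ : ∀ i j → lookup xs i < lookup xs j → toℕ i < toℕ j
  lookup-<⁻ i j lt with <-cmp (toℕ i) (toℕ j)
  ... | tri< i<j _ _ = i<j
  ... | tri≈ _ i≡j _ rewrite Fin.toℕ-injective i≡j = ⊥-elim (<-irrefl refl lt)
  ... | tri> _ _ j<i = ⊥-elim (<-asym lt (lookup-< j i j<i))

  lookup-injective : ∀ i j → lookup xs i ≡ lookup xs j → i ≡ j
  lookup-injective i j eq with <-cmp (toℕ i) (toℕ j)
  ... | tri< i<j _ _ = ⊥-elim (<-irrefl eq (lookup-< i j i<j))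
  ... | tri≈ _ i≡j _ = Fin.toℕ-injective i≡j
  ... | tri> _ _ j<i = ⊥-elim (<-irrefl (sym eq) (lookup-< j i j<i))

  lookup-adjacent : ∀ i j → lookup xs i < lookup xs j →
    (∀ m → lookup xs i < lookup xs m → lookup xs m < lookup xs j → ⊥) → toℕ j ≡ suc (toℕ i)
  lookup-adjacent i j lt nothing-between with toℕ j ≟ suc (toℕ i)
  ... | yes adj = adj
  ... | no ¬adj = ⊥-elim (nothing-between m (lookup-< i m i<m) (lookup-< m j m<j))
    where
    gap : suc (toℕ i) < toℕ j
    gap = ≤∧≢⇒< (lookup-<⁻ i j lt) (¬adj ∘ sym)
    m : Fin (length xs)
    m = fromℕ< (<-trans gap (Fin.toℕ<n j))
    i<m : toℕ i < toℕ m
    i<m = subst (toℕ i <_) (sym (Fin.toℕ-fromℕ< _)) ≤-refl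
    m<j : toℕ m < toℕ j
    m<j = subst (_< toℕ j) (sym (Fin.toℕ-fromℕ< _)) gap

module Lexicographic (N : ℕ) where

  enc : ℕ → ℕ → ℕ
  enc a b = a * N + b

  enc-<₁ : ∀ {a a′ b b′} → a < a′ → b < N → enc a b < enc a′ b′
  enc-<₁ {a} {a′} {b} {b′} a<a′ b<N = begin-strict
      a * N + b     <⟨ +-monoʳ-< (a * N) b<N ⟩
      a * N + N     ≡⟨ +-comm (a * N) N ⟩
      suc a * N     ≤⟨ *-monoˡ-≤ N a<a′ ⟩
      a′ * N        ≤⟨ m≤m+n (a′ * N) b′ ⟩
      a′ * N + b′   ∎
    where open ≤-Reasoning

  enc-injective : ∀ {a a′ b b′} → b < N → b′ < N → enc a b ≡ enc a′ b′ → a ≡ a′ × b ≡ b′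
  enc-injective {a} {a′} b<N b′<N eq with <-cmp a a′
  ... | tri< a<a′ _ _ = ⊥-elim (<-irrefl eq (enc-<₁ a<a′ b<N))
  ... | tri> _ _ a′<a = ⊥-elim (<-irrefl (sym eq) (enc-<₁ a′<a b′<N))
  ... | tri≈ _ refl _ = refl , +-cancelˡ-≡ (a * N) _ _ eq

  enc-between : ∀ {a a′ b₁ b₂ b′} → b₂ < N → b′ < N →
    enc a b₁ < enc a′ b′ → enc a′ b′ < enc a b₂ → a′ ≡ a
  enc-between {a} {a′} b₂<N b′<N lo hi with <-cmp a a′
  ... | tri≈ _ a≡a′ _ = sym a≡a′
  ... | tri< a<a′ _ _ = ⊥-elim (<-asym hi (enc-<₁ a<a′ b₂<N))
  ... | tri> _ _ a′<a = ⊥-elim (<-asym lo (enc-<₁ a′<a b′<N))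

-- D W x y: there is a path from x to y with intermediate vertices in W
-- (the Floyd–Warshall recursion on W).
module FiniteReachability {A : Set} (R : A → A → Set) (R? : ∀ x y → Dec (R x y))
  (_≟_ : DecidableEquality A) where

  private
    D : List A → A → A → Set
    D [] x y = (x ≡ y) ⊎ R x y
    D (w ∷ W) x y = D W x y ⊎ (D W x w × D W w y)

    D? : ∀ W x y → Dec (D W x y)
    D? [] x y = (x ≟ y) ⊎-dec R? x y
    D? (w ∷ W) x y = D? W x y ⊎-dec (D? W x w ×-dec D? W w y)

    sound : ∀ W {x y} → D W x y → Star R x y
    sound [] (inj₁ refl) = ε
    sound [] (inj₂ r) = r ◅ ε
    sound (w ∷ W) (inj₁ d) = sound W d
    sound (w ∷ W) (inj₂ (d , e)) = sound W d ◅◅ sound W e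

    base : ∀ W {x y} → (x ≡ y) ⊎ R x y → D W x y
    base [] b = b
    base (w ∷ W) b = inj₁ (base W b)

    through : ∀ W {x y z} → y ∈ W → D W x y → D W y z → D W x z
    through (w ∷ W) (here refl) d e = inj₂ (ending d , starting e)
      where
      ending : ∀ {x} → D (w ∷ W) x w → D W x w
      ending (inj₁ a) = a
      ending (inj₂ (b , _)) = b
      starting : ∀ {z} → D (w ∷ W) w z → D W w z
      starting (inj₁ a) = a
      starting (inj₂ (_ , c)) = c
    through (w ∷ W) (there i) (inj₁ a) (inj₁ a′) = inj₁ (through W i a a′)
    through (w ∷ W) (there i) (inj₁ a) (inj₂ (b′ , c′)) = inj₂ (through W i a b′ , c′)
    through (w ∷ W) (there i) (inj₂ (b , c)) (inj₁ a′) = inj₂ (b , through W i c a′)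
    through (w ∷ W) (there i) (inj₂ (b , _)) (inj₂ (_ , c′)) = inj₂ (b , c′)

    complete : ∀ V → (∀ {x y} → R x y → y ∈ V) → ∀ {x y} → Star R x y → D V x y
    complete V closed ε = base V (inj₁ refl)
    complete V closed (r ◅ s) = through V (closed r) (base V (inj₂ r)) (complete V closed s)

  reachable? : ∀ V → (∀ {x y} → R x y → y ∈ V) → ∀ x y → Dec (Star R x y)
  reachable? V closed x y with D? V x y
  ... | yes d = yes (sound V d)
  ... | no ¬d = no (λ s → ¬d (complete V closed s))

module Cardinality {sch : Schema} where

  open Pigeonhole ℕ._≟_
  open DecMembership ℕ._≟_ using (_∈?_)

  values : Instance sch → Pos sch → List ℕ
  values I (R , p) = deduplicate ℕ._≟_ (map (λ t → Vec.lookup t p) (I R))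

  card : Instance sch → Pos sch → ℕ
  card I x = length (values I x)

  values-unique : ∀ I x → Unique (values I x)
  values-unique I (R , p) = deduplicate-! ℕ._≟_ _

  occurs⇒∈ : ∀ I {a} x → OccursAt I a x → a ∈ values I x
  occurs⇒∈ I (R , p) (t , t∈ , refl) = ∈-deduplicate⁺ ℕ._≟_ (∈-map⁺ (λ t → Vec.lookup t p) t∈)

  ∈⇒occurs : ∀ I {a} x → a ∈ values I x → OccursAt I a x
  ∈⇒occurs I (R , p) a∈ with ∈-map⁻ (λ t → Vec.lookup t p) (∈-deduplicate⁻ ℕ._≟_ _ a∈)
  ... | t , t∈ , eq = t , t∈ , sym eq

  uid-card : ∀ I a b → SatUID I (a ⊆ᵘ b) → card I a ≤ card I b
  uid-card I a b sat = injection-≤ _≡_ (values-unique I a) (values-unique I b)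
    (λ {v} v∈ → v , occurs⇒∈ I b (sat v (∈⇒occurs I a v∈)) , refl) (λ { _ _ refl refl → refl })

  uid-card-reverse : ∀ I a b → SatUID I (a ⊆ᵘ b) → card I b ≤ card I a → SatUID I (b ⊆ᵘ a)
  uid-card-reverse I a b sat b≤a v v∈b with v ∈? values I a
  ... | yes v∈a = ∈⇒occurs I a v∈a
  ... | no v∉a = ⊥-elim (<-irrefl refl (≤-trans a<b b≤a))
    where
    -- adding v to the values at a still injects into the values at b
    a<b : suc (card I a) ≤ card I b
    a<b = injection-≤ _≡_ (¬Any⇒All¬ _ v∉a ∷ values-unique I a) (values-unique I b)
      (λ { {_} (here refl) → v , occurs⇒∈ I b v∈b , refl
         ; {w} (there w∈) → w , occurs⇒∈ I b (sat w (∈⇒occurs I a w∈)) , refl })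
      (λ { _ _ refl refl → refl })

  -- for an FD R^i → R^j: relate each value w at R^j to the R^i-values of the facts
  -- carrying w; by the FD this relation is total and injective
  module _ (I : Instance sch) (R : Fin (nRel sch)) (i j : Fin (arity sch R)) where

    SameFact : ℕ → ℕ → Set
    SameFact w v = ∃ λ t → t ∈ I R × Vec.lookup t j ≡ w × Vec.lookup t i ≡ v

    private
      total : Total SameFact (values I (R , j)) (values I (R , i))
      total w∈ with ∈⇒occurs I (R , j) w∈
      ... | t , t∈ , eq = Vec.lookup t i , occurs⇒∈ I (R , i) (t , t∈ , refl) , t , t∈ , eq , refl

      injective : SatUFD I (ufd R i j) → Injective SameFact (values I (R , j))
      injective sat _ _ (t , t∈ , refl , eq) (t′ , t′∈ , refl , eq′) = sat t t′ t∈ t′∈ (trans eq (sym eq′))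

    ufd-card : SatUFD I (ufd R i j) → card I (R , j) ≤ card I (R , i)
    ufd-card sat = injection-≤ SameFact (values-unique I _) (values-unique I _) total (injective sat)

    ufd-card-reverse : SatUFD I (ufd R i j) → card I (R , i) ≤ card I (R , j) → SatUFD I (ufd R j i)
    ufd-card-reverse sat i≤j t t′ t∈ t′∈ same-j with Vec.lookup t i ℕ.≟ Vec.lookup t′ i
    ... | yes same-i = same-i
    ... | no differ = ⊥-elim (<-irrefl refl (≤-trans j<i i≤j))
      where
      -- the value t[j] = t′[j] is related to the two different values t[i] and t′[i]
      j<i : suc (card I (R , j)) ≤ card I (R , i)
      j<i = injection-< SameFact (values-unique I _) (values-unique I _) total (injective sat)
        (occurs⇒∈ I (R , j) (t , t∈ , refl)) (occurs⇒∈ I (R , i) (t , t∈ , refl))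
        (occurs⇒∈ I (R , i) (t′ , t′∈ , refl)) differ
        (t , t∈ , refl , refl) (t′ , t′∈ , sym same-j , refl)

module Implication {sch : Schema} (ΣUFD : List (UFD sch)) (ΣUID : List (UID sch))
  (nonTrivial : All NonTrivialUID ΣUID) (closed : ClosedUnderFinImp ΣUFD ΣUID) where

  open Cardinality

  _≼_ : Pos sch → Pos sch → Set
  a ≼ b = (I : Instance sch) → SatAll I ΣUFD ΣUID → card I a ≤ card I b

  ≼-refl : ∀ {a} → a ≼ a
  ≼-refl I _ = ≤-refl

  ≼-trans : ∀ {a b c} → a ≼ b → b ≼ c → a ≼ c
  ≼-trans a≼b b≼c I sat = ≤-trans (a≼b I sat) (b≼c I sat)

  UIDIn : Pos sch → Pos sch → Set
  UIDIn a b = (a ⊆ᵘ b) ∈ ΣUID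

  FDIn : Pos sch → Pos sch → Set
  FDIn = UFDIn ΣUFD ΣUID

  private
    data FDView : Pos sch → Pos sch → Set where
      fd : ∀ R i j → ufd R i j ∈ ΣUFD → FDView (R , i) (R , j)

    view : ∀ {x y} → FDIn x y → FDView x y
    view x→y with find x→y
    ... | ufd R i j , φ∈ , refl , refl = fd R i j φ∈

    unview : ∀ {x y} → FDView x y → FDIn x y
    unview (fd R i j φ∈) = Any.map (λ { refl → refl , refl }) φ∈

  uid-≼ : ∀ {a b} → UIDIn a b → a ≼ b
  uid-≼ {a} {b} τ∈ I sat = uid-card I a b (All.lookup (proj₂ sat) τ∈)

  fd-≼ : ∀ {x y} → FDIn x y → y ≼ x
  fd-≼ x→y with view x→y
  ... | fd R i j φ∈ = λ I sat → ufd-card I R i j (All.lookup (proj₁ sat) φ∈)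

  uid-nontrivial : ∀ {a b} → UIDIn a b → a ≢ b
  uid-nontrivial = All.lookup nonTrivial

  uid-reverse : ∀ {a b} → UIDIn a b → b ≼ a → UIDIn b a
  uid-reverse {a} {b} τ∈ b≼a = proj₁ closed (b ⊆ᵘ a) (uid-nontrivial τ∈ ∘ sym)
    (λ I sat → uid-card-reverse I a b (All.lookup (proj₂ sat) τ∈) (b≼a I sat))

  fd-reverse : ∀ {x y} → FDIn x y → x ≼ y → FDIn y x
  fd-reverse x→y x≼y with view x→y
  ... | fd R i j φ∈ = unview (fd R j i (proj₂ closed (ufd R j i)
          (λ I sat → ufd-card-reverse I R i j (All.lookup (proj₁ sat) φ∈) (x≼y I sat))))

  uid-trans : ∀ {a b c} → UIDIn a b → UIDIn b c → a ≢ c → UIDIn a c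
  uid-trans {a} {b} {c} a⊆b b⊆c a≢c = proj₁ closed (a ⊆ᵘ c) a≢c
    (λ I sat v v∈a → All.lookup (proj₂ sat) b⊆c v (All.lookup (proj₂ sat) a⊆b v v∈a))

  fd-trans : ∀ {x y z} → FDIn x y → FDIn y z → FDIn x z
  fd-trans x→y y→z with view x→y | view y→z
  ... | fd R i j φ∈ | fd .R .j k ψ∈ = unview (fd R i k (proj₂ closed (ufd R i k)
          (λ I sat t t′ t∈ t′∈ same → All.lookup (proj₁ sat) ψ∈ t t′ t∈ t′∈
             (All.lookup (proj₁ sat) φ∈ t t′ t∈ t′∈ same))))

module Graph {sch : Schema} (ΣUFD : List (UFD sch)) (ΣUID : List (UID sch))
  (nonTrivial : All NonTrivialUID ΣUID) (closed : ClosedUnderFinImp ΣUFD ΣUID) where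

  open Implication ΣUFD ΣUID nonTrivial closed public

  _≟ᵖ_ : DecidableEquality (Pos sch)
  _≟ᵖ_ = Product.≡-dec Fin._≟_ Fin._≟_

  _≟ᵘ_ : DecidableEquality (UID sch)
  (a ⊆ᵘ b) ≟ᵘ (c ⊆ᵘ d) with a ≟ᵖ c | b ≟ᵖ d
  ... | yes refl | yes refl = yes refl
  ... | no a≢c | _ = no λ { refl → a≢c refl }
  ... | _ | no b≢d = no λ { refl → b≢d refl }

  uid-ext : ∀ {σ ρ : UID sch} → src σ ≡ src ρ → tgt σ ≡ tgt ρ → σ ≡ ρ
  uid-ext {a ⊆ᵘ b} refl refl = refl

  infix 4 _↣_ _↣*_ _∼_

  _↣_ : UID sch → UID sch → Set
  _↣_ = Edge ΣUFD ΣUID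

  _↣*_ : UID sch → UID sch → Set
  _↣*_ = Reach ΣUFD ΣUID

  _∼_ : UID sch → UID sch → Set
  τ ∼ σ = τ ↣* σ × σ ↣* τ

  ∼-sym : ∀ {τ σ} → τ ∼ σ → σ ∼ τ
  ∼-sym (τσ , στ) = στ , τσ

  ∼-trans : ∀ {τ σ ρ} → τ ∼ σ → σ ∼ ρ → τ ∼ ρ
  ∼-trans (τσ , στ) (σρ , ρσ) = τσ ◅◅ σρ , ρσ ◅◅ στ

  ↣-∈₁ : ∀ {τ σ} → τ ↣ σ → τ ∈ ΣUID
  ↣-∈₁ (τ∈ , _) = τ∈

  ↣-∈₂ : ∀ {τ σ} → τ ↣ σ → σ ∈ ΣUID
  ↣-∈₂ (_ , σ∈ , _) = σ∈

  ↣*-∈ : ∀ {τ σ} → τ ∈ ΣUID → τ ↣* σ → σ ∈ ΣUID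
  ↣*-∈ τ∈ ε = τ∈
  ↣*-∈ τ∈ (e ◅ p) = ↣*-∈ (↣-∈₂ e) p

  retarget : ∀ {ζ τ α} → ζ ↣ τ → α ∈ ΣUID → src α ≡ src τ → ζ ↣ α
  retarget (ζ∈ , _ , ne , x→y) α∈ refl = ζ∈ , α∈ , ne , x→y

  reorigin : ∀ {τ σ α} → τ ↣ σ → α ∈ ΣUID → tgt α ≡ tgt τ → α ↣ σ
  reorigin (_ , σ∈ , ne , x→y) α∈ refl = α∈ , σ∈ , ne , x→y

  FDIn? : ∀ x y → Dec (FDIn x y)
  FDIn? x y = any? (λ φ → ((rel φ , lhs φ) ≟ᵖ x) ×-dec ((rel φ , rhs φ) ≟ᵖ y)) ΣUFD

  open DecMembership _≟ᵘ_ using (_∈?_)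

  _↣?_ : ∀ τ σ → Dec (τ ↣ σ)
  τ ↣? σ = (τ ∈? ΣUID) ×-dec ((σ ∈? ΣUID) ×-dec (¬? (src σ ≟ᵖ tgt τ) ×-dec FDIn? (src σ) (tgt τ)))

  -- opaque, so that type checking never unfolds the decision procedure
  opaque
    _↣*?_ : ∀ τ σ → Dec (τ ↣* σ)
    _↣*?_ = FiniteReachability.reachable? _↣_ _↣?_ _≟ᵘ_ ΣUID ↣-∈₂

  ↣-mono : ∀ {τ σ} → τ ↣ σ → tgt τ ≼ src σ
  ↣-mono (_ , _ , _ , x→y) = fd-≼ x→y

  ↣*-mono-src : ∀ {τ σ} → τ ↣* σ → src τ ≼ src σ
  ↣*-mono-src ε = ≼-refl
  ↣*-mono-src (e ◅ p) = ≼-trans (uid-≼ (↣-∈₁ e)) (≼-trans (↣-mono e) (↣*-mono-src p))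

  ↣*-mono-tgt : ∀ {τ σ} → τ ↣* σ → tgt τ ≼ tgt σ
  ↣*-mono-tgt ε = ≼-refl
  ↣*-mono-tgt (e ◅ p) = ≼-trans (↣-mono e) (≼-trans (uid-≼ (↣-∈₂ e)) (↣*-mono-tgt p))

  -- an edge τ ↣ σ with |tgt σ| ≤ |src τ| has all cardinalities on it equal, so it
  -- reverses to σ⁻¹ ↣ τ⁻¹
  reverse-edge : ∀ {τ σ} → τ ↣ σ → tgt σ ≼ src τ → (σ ⁻¹ᵘ) ↣ (τ ⁻¹ᵘ)
  reverse-edge e@(τ∈ , σ∈ , ne , x→y) tgtσ≼srcτ =
    uid-reverse σ∈ (≼-trans tgtσ≼srcτ (≼-trans (uid-≼ τ∈) (↣-mono e))) ,
    uid-reverse τ∈ (≼-trans (↣-mono e) (≼-trans (uid-≼ σ∈) tgtσ≼srcτ)) ,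
    ne ∘ sym ,
    fd-reverse x→y (≼-trans (uid-≼ σ∈) (≼-trans tgtσ≼srcτ (uid-≼ τ∈)))

  reverse-path : ∀ {τ σ} → τ ↣* σ → tgt σ ≼ src τ → (σ ⁻¹ᵘ) ↣* (τ ⁻¹ᵘ)
  reverse-path ε _ = ε
  reverse-path (e ◅ p) tgtσ≼srcτ =
    reverse-path p (≼-trans tgtσ≼srcτ (≼-trans (uid-≼ (↣-∈₁ e)) (↣-mono e)))
      ◅◅ (reverse-edge e (≼-trans (↣*-mono-tgt p) tgtσ≼srcτ) ◅ ε)

  -- τ lies on a cycle of Γ, i.e. the SCC of τ is non-trivial
  OnCycle : UID sch → Set
  OnCycle τ = ∃ λ ρ → τ ↣ ρ × ρ ↣* τ

  onCycle? : ∀ τ → Dec (OnCycle τ)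
  onCycle? τ with any? (λ ρ → (τ ↣? ρ) ×-dec (ρ ↣*? τ)) ΣUID
  ... | yes found = yes (proj₁ (find found) , proj₂ (proj₂ (find found)))
  ... | no none = no (λ { (ρ , e , p) → none (lose (↣-∈₂ e) (e , p)) })

  onCycle-∈ : ∀ {τ} → OnCycle τ → τ ∈ ΣUID
  onCycle-∈ (_ , e , _) = ↣-∈₁ e

  -- on a cycle all cardinalities are equal; in particular |tgt τ| ≤ |src τ|
  onCycle-tight : ∀ {τ} → OnCycle τ → tgt τ ≼ src τ
  onCycle-tight (_ , e , p) = ≼-trans (↣-mono e) (↣*-mono-src p)

  onCycle-inverse-∈ : ∀ {τ} → OnCycle τ → (τ ⁻¹ᵘ) ∈ ΣUID
  onCycle-inverse-∈ c = uid-reverse (onCycle-∈ c) (onCycle-tight c)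

  last-edge : ∀ {τ ρ σ} → τ ↣ ρ → ρ ↣* σ → ∃ λ ζ → τ ↣* ζ × ζ ↣ σ
  last-edge e ε = _ , ε , e
  last-edge e (e′ ◅ p) with last-edge e′ p
  ... | ζ , q , e″ = ζ , e ◅ q , e″

  cycle-predecessor : ∀ {τ} → OnCycle τ → ∃ λ ζ → τ ↣* ζ × ζ ↣ τ
  cycle-predecessor (ρ , e , p) = last-edge e p

  first-edge : ∀ {σ θ} → σ ↣* θ → OnCycle θ → ∃ λ σ′ → σ ↣ σ′ × σ′ ↣* θ
  first-edge ε c = c
  first-edge (e ◅ p) _ = _ , e , p

  onCycle-∼ : ∀ {τ σ} → OnCycle τ → τ ∼ σ → OnCycle σ
  onCycle-∼ c (_ , ε) = c
  onCycle-∼ (ρ , e , p) (τσ , e′ ◅ p′) = _ , e′ , (p′ ◅◅ (e ◅ (p ◅◅ τσ)))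

  -- inverting a cycle: reverse the edge into τ
  onCycle-inverse : ∀ {τ} → OnCycle τ → OnCycle (τ ⁻¹ᵘ)
  onCycle-inverse c with cycle-predecessor c
  ... | ζ , τζ , ζτ = ζ ⁻¹ᵘ , reverse-edge ζτ (≼-trans (onCycle-tight c) (↣*-mono-src τζ)) ,
                      reverse-path τζ (↣-mono ζτ)

  inverse-∼ : ∀ {τ σ} → OnCycle τ → τ ∼ σ → (τ ⁻¹ᵘ) ∼ (σ ⁻¹ᵘ)
  inverse-∼ c (τσ , στ) =
    reverse-path στ (≼-trans (onCycle-tight c) (↣*-mono-src τσ)) ,
    reverse-path τσ (≼-trans (↣*-mono-tgt στ) (onCycle-tight c))

  leave-scc : ∀ {π y} → π ↣* y → ¬ (y ↣* π) →
    ∃₂ λ ρ σ → π ∼ ρ × ρ ↣ σ × ¬ (σ ↣* π) × σ ↣* y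
  leave-scc = go (ε , ε)
    where
    go : ∀ {π x y} → π ∼ x → x ↣* y → ¬ (y ↣* π) →
      ∃₂ λ ρ σ → π ∼ ρ × ρ ↣ σ × ¬ (σ ↣* π) × σ ↣* y
    go (_ , xπ) ε ¬yπ = ⊥-elim (¬yπ xπ)
    go {π} (πx , xπ) (_◅_ {j = x′} e p) ¬yπ with x′ ↣*? π
    ... | yes x′π = go (πx ◅◅ (e ◅ ε) , x′π) p ¬yπ
    ... | no ¬x′π = _ , _ , (πx , xπ) , e , ¬x′π , p

  -- Take an edge ρ ↣ ρ′ inside the SCC: the FD of σ's edge
  -- composed with the (reversible) FD of ρ′'s edge gives src σ → src ρ′, so ρ′⁻¹,
  -- which lies in the SCC of π⁻¹, has an edge to σ; when src σ = src ρ′ the UID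
  -- tgt ρ′ ⊆ tgt σ takes the place of σ.
  exit-from-inverse : ∀ {π ρ σ θ} → OnCycle π → π ∼ ρ → ρ ↣ σ → ¬ (σ ↣* π) →
    σ ↣* θ → OnCycle θ → (π ⁻¹ᵘ) ↣* θ
  exit-from-inverse {π} {ρ} {σ} {θ} cπ πρ (ρ∈ , σ∈ , _ , σ→ρ) σ↛π σθ cθ
    with onCycle-∼ cπ πρ
  ... | ρ′ , ρρ′ , ρ′ρ = proj₁ (inverse-∼ cπ πρ′) ◅◅ from-ρ′⁻¹
    where
    πρ′ : π ∼ ρ′
    πρ′ = ∼-trans πρ (ρρ′ ◅ ε , ρ′ρ)
    cρ′ : OnCycle ρ′
    cρ′ = onCycle-∼ cπ πρ′
    σ→ρ′ : FDIn (src σ) (src ρ′)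
    σ→ρ′ = fd-trans σ→ρ (fd-reverse (proj₂ (proj₂ (proj₂ ρρ′))) (≼-trans (↣*-mono-src ρ′ρ) (uid-≼ ρ∈)))
    from-ρ′⁻¹ : (ρ′ ⁻¹ᵘ) ↣* θ
    from-ρ′⁻¹ with src σ ≟ᵖ src ρ′
    ... | no src-differ = (onCycle-inverse-∈ cρ′ , σ∈ , src-differ , σ→ρ′) ◅ σθ
    ... | yes same-src with cycle-predecessor (onCycle-inverse cρ′) | first-edge σθ cθ
    ...   | ζ , ρ′⁻¹ζ , ζρ′⁻¹ | σ′ , σσ′ , σ′θ =
      ρ′⁻¹ζ ◅◅ (retarget ζρ′⁻¹ α∈ refl ◅ reorigin σσ′ α∈ refl ◅ σ′θ)
      where
      -- σ ≠ ρ′ since σ leaves the SCC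
      tgt-differ : tgt ρ′ ≢ tgt σ
      tgt-differ eq = σ↛π (subst (_↣* π) (uid-ext (sym same-src) eq) (ρ′ρ ◅◅ proj₂ πρ))
      -- the UID tgt ρ′ ⊆ src ρ′ = src σ ⊆ tgt σ
      α∈ : UIDIn (tgt ρ′) (tgt σ)
      α∈ = uid-trans (onCycle-inverse-∈ cρ′) (subst (λ a → UIDIn a (tgt σ)) same-src σ∈) tgt-differ

-- Suppose π is cyclic,
-- π ↣* π⁻¹ but not π⁻¹ ↣* π, and let Q be the SCC of π⁻¹.  All positions of Q have
-- the cardinality of src π.  Closure under finite implication makes the relation
-- "a → b is a UFD" injective from the targets of Q to its sources, and "a ⊆ b is a
-- UID" injective from the sources to the targets, so both sets have the same size.
-- The edge by which a path from π first enters Q, however, makes one of the two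
-- injections non-functional, contradicting the strict pigeonhole principle.
module SelfInverse {sch : Schema} (ΣUFD : List (UFD sch)) (ΣUID : List (UID sch))
  (nonTrivial : All NonTrivialUID ΣUID) (closed : ClosedUnderFinImp ΣUFD ΣUID) where

  open Graph ΣUFD ΣUID nonTrivial closed
  open Pigeonhole _≟ᵖ_

  module Contradiction {π : UID sch} (cπ : OnCycle π) (π↣*q : π ↣* (π ⁻¹ᵘ)) (q↛π : ¬ ((π ⁻¹ᵘ) ↣* π)) where

    q : UID sch
    q = π ⁻¹ᵘ

    cq : OnCycle q
    cq = onCycle-inverse cπ

    InQ : UID sch → Set
    InQ ρ = q ∼ ρ

    InQ? : ∀ ρ → Dec (InQ ρ)
    InQ? ρ = (q ↣*? ρ) ×-dec (ρ ↣*? q)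

    inQ-cyclic : ∀ {ρ} → InQ ρ → OnCycle ρ
    inQ-cyclic = onCycle-∼ cq

    inQ-∈ : ∀ {ρ} → InQ ρ → ρ ∈ ΣUID
    inQ-∈ = onCycle-∈ ∘ inQ-cyclic

    -- inverses of members of Q lie in the SCC of π, which Q cannot reach
    ↛inverse : ∀ {ρ ρ′} → InQ ρ → InQ ρ′ → ¬ (ρ ↣* (ρ′ ⁻¹ᵘ))
    ↛inverse ρ∈Q ρ′∈Q ρ↣*ρ′⁻¹ = q↛π (proj₁ ρ∈Q ◅◅ (ρ↣*ρ′⁻¹ ◅◅ proj₂ (inverse-∼ cq ρ′∈Q)))

    sources targets : List (Pos sch)
    sources = deduplicate _≟ᵖ_ (map src (filter InQ? ΣUID))
    targets = deduplicate _≟ᵖ_ (map tgt (filter InQ? ΣUID))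

    sources-unique : Unique sources
    sources-unique = deduplicate-! _≟ᵖ_ _

    targets-unique : Unique targets
    targets-unique = deduplicate-! _≟ᵖ_ _

    src∈sources : ∀ {ρ} → InQ ρ → src ρ ∈ sources
    src∈sources ρ∈Q = ∈-deduplicate⁺ _≟ᵖ_ (∈-map⁺ src (∈-filter⁺ InQ? (inQ-∈ ρ∈Q) ρ∈Q))

    tgt∈targets : ∀ {ρ} → InQ ρ → tgt ρ ∈ targets
    tgt∈targets ρ∈Q = ∈-deduplicate⁺ _≟ᵖ_ (∈-map⁺ tgt (∈-filter⁺ InQ? (inQ-∈ ρ∈Q) ρ∈Q))

    sources⁻ : ∀ {a} → a ∈ sources → ∃ λ ρ → InQ ρ × a ≡ src ρ
    sources⁻ a∈ with ∈-map⁻ src (∈-deduplicate⁻ _≟ᵖ_ _ a∈)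
    ... | ρ , ρ∈ , refl = ρ , proj₂ (∈-filter⁻ InQ? {xs = ΣUID} ρ∈) , refl

    targets⁻ : ∀ {b} → b ∈ targets → ∃ λ ρ → InQ ρ × b ≡ tgt ρ
    targets⁻ b∈ with ∈-map⁻ tgt (∈-deduplicate⁻ _≟ᵖ_ _ b∈)
    ... | ρ , ρ∈ , refl = ρ , proj₂ (∈-filter⁻ InQ? {xs = ΣUID} ρ∈) , refl

    Level : Pos sch → Set
    Level x = (x ≼ src π) × (src π ≼ x)

    level : ∀ {x y} → Level x → Level y → x ≼ y
    level (x≼π , _) (_ , π≼y) = ≼-trans x≼π π≼y

    level-src : ∀ {ρ} → InQ ρ → Level (src ρ)
    level-src (qρ , ρq) = ≼-trans (↣*-mono-src ρq) (onCycle-tight cπ) , ≼-trans (uid-≼ (onCycle-∈ cπ)) (↣*-mono-src qρ)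

    level-tgt : ∀ {ρ} → InQ ρ → Level (tgt ρ)
    level-tgt (qρ , ρq) = ↣*-mono-tgt ρq , ↣*-mono-tgt qρ

    sources-level : ∀ {a} → a ∈ sources → Level a
    sources-level a∈ with sources⁻ a∈
    ... | ρ , ρ∈Q , refl = level-src ρ∈Q

    targets-level : ∀ {b} → b ∈ targets → Level b
    targets-level b∈ with targets⁻ b∈
    ... | ρ , ρ∈Q , refl = level-tgt ρ∈Q

    -- different targets of Q are not linked by a UFD of Σ: otherwise ρ′ ↣ ρ⁻¹
    targets-fd-free : ∀ {ρ ρ′} → InQ ρ → InQ ρ′ → tgt ρ ≢ tgt ρ′ → ¬ FDIn (tgt ρ) (tgt ρ′)
    targets-fd-free ρ∈Q ρ′∈Q differ ρ→ρ′ =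
      ↛inverse ρ′∈Q ρ∈Q ((inQ-∈ ρ′∈Q , onCycle-inverse-∈ (inQ-cyclic ρ∈Q) , differ , ρ→ρ′) ◅ ε)

    -- different sources of Q are not linked by a UID α of Σ: otherwise ρ ↣* α ↣* ρ′⁻¹
    sources-uid-free : ∀ {ρ ρ′} → InQ ρ → InQ ρ′ → src ρ ≢ src ρ′ → ¬ UIDIn (src ρ) (src ρ′)
    sources-uid-free {ρ} {ρ′} ρ∈Q ρ′∈Q differ α∈ =
      ↛inverse ρ∈Q ρ′∈Q (ρζ ◅◅ (retarget ζρ α∈ refl ◅ reorigin ρ′⁻¹ξ α∈ refl ◅ ξρ′⁻¹))
      where
      predecessor : ∃ λ ζ → ρ ↣* ζ × ζ ↣ ρ
      predecessor = cycle-predecessor (inQ-cyclic ρ∈Q)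
      ρζ : ρ ↣* proj₁ predecessor
      ρζ = proj₁ (proj₂ predecessor)
      ζρ : proj₁ predecessor ↣ ρ
      ζρ = proj₂ (proj₂ predecessor)
      successor : OnCycle (ρ′ ⁻¹ᵘ)
      successor = onCycle-inverse (inQ-cyclic ρ′∈Q)
      ρ′⁻¹ξ : (ρ′ ⁻¹ᵘ) ↣ proj₁ successor
      ρ′⁻¹ξ = proj₁ (proj₂ successor)
      ξρ′⁻¹ : proj₁ successor ↣* (ρ′ ⁻¹ᵘ)
      ξρ′⁻¹ = proj₂ (proj₂ successor)

    FDFrom : Pos sch → Pos sch → Set
    FDFrom b a = FDIn a b × a ≢ b × a ∈ sources

    targets→sources : Total FDFrom targets sources
    targets→sources b∈ with targets⁻ b∈
    ... | ρ , ρ∈Q , refl with inQ-cyclic ρ∈Q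
    ...   | ρ⁺ , ρρ⁺@(_ , _ , ne , ρ⁺→ρ) , ρ⁺ρ = src ρ⁺ , a∈ , ρ⁺→ρ , ne , a∈
      where
      a∈ : src ρ⁺ ∈ sources
      a∈ = src∈sources (∼-trans ρ∈Q (ρρ⁺ ◅ ε , ρ⁺ρ))

    targets→sources-injective : Injective FDFrom targets
    targets→sources-injective {b} {b′} b∈ b′∈ (a→b , _ , a∈) (a→b′ , _) with b ≟ᵖ b′
    ... | yes same = same
    ... | no differ with targets⁻ b∈ | targets⁻ b′∈
    ...   | ρ , ρ∈Q , refl | ρ′ , ρ′∈Q , refl = ⊥-elim (targets-fd-free ρ∈Q ρ′∈Q differ
            (fd-trans (fd-reverse a→b (level (sources-level a∈) (level-tgt ρ∈Q))) a→b′))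

    UIDTo : Pos sch → Pos sch → Set
    UIDTo a b = UIDIn a b × b ∈ targets

    sources→targets : Total UIDTo sources targets
    sources→targets a∈ with sources⁻ a∈
    ... | ρ , ρ∈Q , refl = tgt ρ , tgt∈targets ρ∈Q , inQ-∈ ρ∈Q , tgt∈targets ρ∈Q

    sources→targets-injective : Injective UIDTo sources
    sources→targets-injective {a} {a′} a∈ a′∈ (a⊆b , b∈) (a′⊆b , _) with a ≟ᵖ a′
    ... | yes same = same
    ... | no differ with sources⁻ a∈ | sources⁻ a′∈
    ...   | ρ , ρ∈Q , refl | ρ′ , ρ′∈Q , refl = ⊥-elim (sources-uid-free ρ∈Q ρ′∈Q differ
            (uid-trans a⊆b (uid-reverse a′⊆b (level (targets-level b∈) (level-src ρ′∈Q))) differ))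

    targets≤sources : length targets ≤ length sources
    targets≤sources = injection-≤ FDFrom targets-unique sources-unique
      targets→sources targets→sources-injective

    sources≤targets : length sources ≤ length targets
    sources≤targets = injection-≤ UIDTo sources-unique targets-unique
      sources→targets sources→targets-injective

    entry : ∃₂ λ ν μ → π ↣* ν × ¬ (q ↣* ν) × ν ↣ μ × InQ μ
    entry = go ε q↛π π↣*q
      where
      go : ∀ {x} → π ↣* x → ¬ (q ↣* x) → x ↣* q → ∃₂ λ ν μ → π ↣* ν × ¬ (q ↣* ν) × ν ↣ μ × InQ μ
      go πx q↛x ε = ⊥-elim (q↛x ε)
      go πx q↛x (_◅_ {j = x′} e x′q) with q ↣*? x′
      ... | yes qx′ = _ , _ , πx , q↛x , e , qx′ , x′q
      ... | no q↛x′ = go (πx ◅◅ (e ◅ ε)) q↛x′ x′q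

    module Entry {ν μ κ : UID sch} (πν : π ↣* ν) (q↛ν : ¬ (q ↣* ν)) (νμ : ν ↣ μ) (μ∈Q : InQ μ)
      (κμ : κ ↣ μ) (κ∈Q : InQ κ) where

      ν∈ : ν ∈ ΣUID
      ν∈ = ↣-∈₁ νμ

      κ∈ : κ ∈ ΣUID
      κ∈ = ↣-∈₁ κμ

      tgtν≼π : tgt ν ≼ src π
      tgtν≼π = ≼-trans (↣-mono νμ) (proj₁ (level-src μ∈Q))

      ν⁻¹∈ : (ν ⁻¹ᵘ) ∈ ΣUID
      ν⁻¹∈ = uid-reverse ν∈ (≼-trans tgtν≼π (↣*-mono-src πν))

      ν⁻¹q : (ν ⁻¹ᵘ) ↣* q
      ν⁻¹q = reverse-path πν tgtν≼π

      -- if tgt ν ≠ tgt κ then κ ↣ ν⁻¹, so ν⁻¹ ∈ Q and the target tgt κ of Q has the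
      -- two different UFD-sources src μ and tgt ν in Q
      distinct-targets : tgt ν ≢ tgt κ → ⊥
      distinct-targets differ = <-irrefl refl (≤-trans targets<sources sources≤targets)
        where
        μ→ν : FDIn (src μ) (tgt ν)
        μ→ν = proj₂ (proj₂ (proj₂ νμ))
        μ→κ : FDIn (src μ) (tgt κ)
        μ→κ = proj₂ (proj₂ (proj₂ κμ))
        ν→κ : FDIn (tgt ν) (tgt κ)
        ν→κ = fd-trans (fd-reverse μ→ν (≼-trans (proj₁ (level-src μ∈Q))
                (≼-trans (↣*-mono-src πν) (uid-≼ ν∈)))) μ→κ
        ν⁻¹∈Q : InQ (ν ⁻¹ᵘ)
        ν⁻¹∈Q = proj₁ κ∈Q ◅◅ ((κ∈ , ν⁻¹∈ , differ , ν→κ) ◅ ε) , ν⁻¹q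
        targets<sources : length targets < length sources
        targets<sources = injection-< FDFrom targets-unique sources-unique
          targets→sources targets→sources-injective
          (tgt∈targets κ∈Q) (src∈sources μ∈Q) (src∈sources ν⁻¹∈Q) (proj₁ (proj₂ (proj₂ νμ)))
          (μ→κ , proj₁ (proj₂ (proj₂ κμ)) , src∈sources μ∈Q) (ν→κ , differ , src∈sources ν⁻¹∈Q)

      -- if tgt ν = tgt κ then β = src κ ⊆ src ν is in Σ and in Q, and the source src κ
      -- of Q has the two different UID-targets tgt κ and src ν in Q
      same-target : tgt ν ≡ tgt κ → ⊥
      same-target same = <-irrefl refl (≤-trans sources<targets targets≤sources)
        where
        src-differ : src κ ≢ src ν
        src-differ eq = q↛ν (subst (q ↣*_) (uid-ext eq (sym same)) (proj₁ κ∈Q))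
        β∈ : UIDIn (src κ) (src ν)
        β∈ = uid-trans κ∈ (subst (λ b → UIDIn b (src ν)) same ν⁻¹∈) src-differ
        predecessor : ∃ λ ζ → κ ↣* ζ × ζ ↣ κ
        predecessor = cycle-predecessor (inQ-cyclic κ∈Q)
        successor : ∃ λ χ → (ν ⁻¹ᵘ) ↣ χ × χ ↣* q
        successor = first-edge ν⁻¹q cq
        β∈Q : InQ (src κ ⊆ᵘ src ν)
        β∈Q = proj₁ κ∈Q ◅◅ (proj₁ (proj₂ predecessor) ◅◅ (retarget (proj₂ (proj₂ predecessor)) β∈ refl ◅ ε)) ,
              reorigin (proj₁ (proj₂ successor)) β∈ refl ◅ proj₂ (proj₂ successor)
        sources<targets : length sources < length targets
        sources<targets = injection-< UIDTo sources-unique targets-unique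
          sources→targets sources→targets-injective
          (src∈sources κ∈Q) (tgt∈targets κ∈Q) (tgt∈targets β∈Q)
          (λ eq → uid-nontrivial ν∈ (trans (sym eq) (sym same)))
          (κ∈ , tgt∈targets κ∈Q) (β∈ , tgt∈targets β∈Q)

    absurd : ⊥
    absurd with entry
    ... | ν , μ , πν , q↛ν , νμ , μ∈Q with cycle-predecessor (inQ-cyclic μ∈Q)
    ...   | κ , μκ , κμ = by-cases (tgt ν ≟ᵖ tgt κ)
      where
      open Entry πν q↛ν νμ μ∈Q κμ (∼-trans μ∈Q (μκ , κμ ◅ ε))
      by-cases : Dec (tgt ν ≡ tgt κ) → ⊥
      by-cases (yes same) = same-target same
      by-cases (no differ) = distinct-targets differ

  self-inverse : ∀ {π} → OnCycle π → π ↣* (π ⁻¹ᵘ) → (π ⁻¹ᵘ) ↣* π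
  self-inverse {π} cπ πq with (π ⁻¹ᵘ) ↣*? π
  ... | yes qπ = qπ
  ... | no q↛π = ⊥-elim (Contradiction.absurd cπ πq q↛π)

-- The graph H obtained from Γ by adding a "jump" τ ⇝ τ⁻¹ at every cyclic τ.  Its
-- strongly connected components are exactly the unions P ∪ P⁻¹ of an SCC with its
-- inverse (for non-trivial P) and the trivial SCCs: the only H-cycles are those
-- that already exist in Γ or that jump between an SCC and its inverse.
module Merged {sch : Schema} (ΣUFD : List (UFD sch)) (ΣUID : List (UID sch))
  (nonTrivial : All NonTrivialUID ΣUID) (closed : ClosedUnderFinImp ΣUFD ΣUID) where

  open Graph ΣUFD ΣUID nonTrivial closed public
  open SelfInverse ΣUFD ΣUID nonTrivial closed public

  -- a cyclic θ reachable from a cyclic π without growth of cardinality is in the SCC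
  -- of π: otherwise leaving the SCC of π (and possibly that of θ⁻¹) and applying
  -- exit-from-inverse leads back to π, or to π⁻¹ and then by self-inverse to π
  return-to-scc : ∀ {π θ} → OnCycle π → π ↣* θ → OnCycle θ → tgt θ ≼ src π → θ ↣* π
  return-to-scc {π} {θ} cπ πθ cθ θ≼π with θ ↣*? π
  ... | yes θπ = θπ
  ... | no θ↛π = via-inverse (π ↣*? (θ ⁻¹ᵘ))
    where
    θ⁻¹π : (θ ⁻¹ᵘ) ↣* π
    θ⁻¹π with leave-scc πθ θ↛π
    ... | ρ , σ , πρ , ρσ , σ↛π , σθ = reverse-path (exit-from-inverse cπ πρ ρσ σ↛π σθ cθ)
                                        (≼-trans θ≼π (uid-≼ (onCycle-∈ cπ)))
    via-inverse : Dec (π ↣* (θ ⁻¹ᵘ)) → θ ↣* π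
    via-inverse (yes πθ⁻¹) = proj₁ θπ⁻¹ ◅◅ self-inverse cπ (πθ ◅◅ proj₁ θπ⁻¹)
      where
      θπ⁻¹ : θ ∼ (π ⁻¹ᵘ)
      θπ⁻¹ = inverse-∼ (onCycle-inverse cθ) (θ⁻¹π , πθ⁻¹)
    via-inverse (no π↛θ⁻¹) with leave-scc θ⁻¹π π↛θ⁻¹
    ... | ρ′ , σ′ , θ⁻¹ρ′ , ρ′σ′ , σ′↛θ⁻¹ , σ′π =
      exit-from-inverse (onCycle-inverse cθ) θ⁻¹ρ′ ρ′σ′ σ′↛θ⁻¹ σ′π cπ

  Jump : UID sch → UID sch → Set
  Jump τ σ = OnCycle τ × σ ≡ τ ⁻¹ᵘ

  infix 4 _⇝_ _⇝*_

  _⇝_ : UID sch → UID sch → Set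
  τ ⇝ σ = τ ↣ σ ⊎ Jump τ σ

  _⇝*_ : UID sch → UID sch → Set
  _⇝*_ = Star _⇝_

  ⇝-∈₂ : ∀ {τ σ} → τ ⇝ σ → σ ∈ ΣUID
  ⇝-∈₂ (inj₁ e) = ↣-∈₂ e
  ⇝-∈₂ (inj₂ (c , refl)) = onCycle-inverse-∈ c

  _⇝?_ : ∀ τ σ → Dec (τ ⇝ σ)
  τ ⇝? σ = (τ ↣? σ) ⊎-dec (onCycle? τ ×-dec (σ ≟ᵘ (τ ⁻¹ᵘ)))

  opaque
    _⇝*?_ : ∀ τ σ → Dec (τ ⇝* σ)
    _⇝*?_ = FiniteReachability.reachable? _⇝_ _⇝?_ _≟ᵘ_ ΣUID ⇝-∈₂

  ⇝*-mono : ∀ {τ σ} → τ ⇝* σ → src τ ≼ src σ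
  ⇝*-mono ε = ≼-refl
  ⇝*-mono (inj₁ e ◅ p) = ≼-trans (uid-≼ (↣-∈₁ e)) (≼-trans (↣-mono e) (⇝*-mono p))
  ⇝*-mono (inj₂ (c , refl) ◅ p) = ≼-trans (uid-≼ (onCycle-∈ c)) (⇝*-mono p)

  ↣*⇒⇝* : ∀ {τ σ} → τ ↣* σ → τ ⇝* σ
  ↣*⇒⇝* ε = ε
  ↣*⇒⇝* (e ◅ p) = inj₁ e ◅ ↣*⇒⇝* p

  first-cyclic : ∀ {τ σ} → τ ⇝* σ → τ ↣* σ ⊎ (∃ λ z → τ ↣* z × OnCycle z × z ⇝* σ)
  first-cyclic ε = inj₁ ε
  first-cyclic (inj₂ (c , refl) ◅ p) = inj₂ (_ , ε , c , inj₂ (c , refl) ◅ p)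
  first-cyclic (inj₁ e ◅ p) with first-cyclic p
  ... | inj₁ q = inj₁ (e ◅ q)
  ... | inj₂ (z , q , c , r) = inj₂ (z , e ◅ q , c , r)

  Paired : UID sch → UID sch → Set
  Paired π σ = σ ∼ π ⊎ σ ∼ (π ⁻¹ᵘ)

  paired-cyclic : ∀ {π σ} → OnCycle π → Paired π σ → OnCycle σ
  paired-cyclic c (inj₁ σπ) = onCycle-∼ c (∼-sym σπ)
  paired-cyclic c (inj₂ σπ⁻¹) = onCycle-∼ (onCycle-inverse c) (∼-sym σπ⁻¹)

  paired-level : ∀ {π σ} → OnCycle π → Paired π σ → (src σ ≼ src π) × (src π ≼ src σ)
  paired-level c (inj₁ (σπ , πσ)) = ↣*-mono-src σπ , ↣*-mono-src πσ
  paired-level c (inj₂ (σπ⁻¹ , π⁻¹σ)) =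
    ≼-trans (↣*-mono-src σπ⁻¹) (onCycle-tight c) , ≼-trans (uid-≼ (onCycle-∈ c)) (↣*-mono-src π⁻¹σ)

  paired-inverse : ∀ {π σ} → OnCycle π → Paired π σ → Paired π (σ ⁻¹ᵘ)
  paired-inverse c (inj₁ σπ) = inj₂ (inverse-∼ (paired-cyclic c (inj₁ σπ)) σπ)
  paired-inverse c (inj₂ σπ⁻¹) = inj₁ (inverse-∼ (paired-cyclic c (inj₂ σπ⁻¹)) σπ⁻¹)

  paired-∼ : ∀ {π σ σ′} → Paired π σ → σ′ ∼ σ → Paired π σ′
  paired-∼ (inj₁ σπ) σ′σ = inj₁ (∼-trans σ′σ σπ)
  paired-∼ (inj₂ σπ⁻¹) σ′σ = inj₂ (∼-trans σ′σ σπ⁻¹)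

  paired-return : ∀ {π σ σ′} → OnCycle π → Paired π σ → Paired π σ′ → σ ↣* σ′ → σ′ ↣* σ
  paired-return c (inj₁ (_ , πσ)) (inj₁ (σ′π , _)) _ = σ′π ◅◅ πσ
  paired-return c (inj₂ (_ , π⁻¹σ)) (inj₂ (σ′π⁻¹ , _)) _ = σ′π⁻¹ ◅◅ π⁻¹σ
  paired-return c (inj₁ (σπ , πσ)) (inj₂ (σ′π⁻¹ , π⁻¹σ′)) σσ′ =
    σ′π⁻¹ ◅◅ (self-inverse c (πσ ◅◅ (σσ′ ◅◅ σ′π⁻¹)) ◅◅ πσ)
  paired-return c (inj₂ (σπ⁻¹ , π⁻¹σ)) (inj₁ (σ′π , πσ′)) σσ′ =
    σ′π ◅◅ (self-inverse (onCycle-inverse c) (π⁻¹σ ◅◅ (σσ′ ◅◅ σ′π)) ◅◅ π⁻¹σ)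

  -- an H-path that starts and ends in the pair class of a cyclic π stays inside it;
  -- a Γ-edge x ↣ x′ leaving the class is excluded by paired-return or return-to-scc
  paired-convex : ∀ {π x y w} → OnCycle π → Paired π x → x ⇝* y → y ⇝* w → Paired π w → Paired π y
  paired-convex cπ px ε _ pw = px
  paired-convex {π} {x} {w = w} cπ px (_◅_ {j = x′} s p) q pw = paired-convex cπ (step s (p ◅◅ q)) p q pw
    where
    step : x ⇝ x′ → x′ ⇝* w → Paired π x′
    step (inj₂ (_ , refl)) _ = paired-inverse cπ px
    step (inj₁ e) x′w with first-cyclic x′w
    ... | inj₁ x′↣*w = paired-∼ px (x′↣*w ◅◅ paired-return cπ px pw (e ◅ x′↣*w) , e ◅ ε)
    ... | inj₂ (z , x′z , cz , zw) =
      paired-∼ px (x′z ◅◅ return-to-scc (paired-cyclic cπ px) (e ◅ x′z) cz z≼x , e ◅ ε)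
      where
      z≼x : tgt z ≼ src x
      z≼x = ≼-trans (onCycle-tight cz) (≼-trans (⇝*-mono zw)
              (≼-trans (proj₁ (paired-level cπ pw)) (proj₂ (paired-level cπ px))))

  paired-on-cycle : ∀ {z y} → OnCycle z → z ⇝* y → y ⇝* z → Paired z y
  paired-on-cycle cz zy yz = paired-convex cz (inj₁ (ε , ε)) zy yz (inj₁ (ε , ε))

  paired-pair : ∀ {z τ σ} → OnCycle z → Paired z τ → Paired z σ →
    σ ∼ τ ⊎ (OnCycle τ × σ ∼ (τ ⁻¹ᵘ))
  paired-pair cz (inj₁ τz) (inj₁ σz) = inj₁ (∼-trans σz (∼-sym τz))
  paired-pair cz (inj₁ τz) (inj₂ σz⁻¹) =
    inj₂ (onCycle-∼ cz (∼-sym τz) , ∼-trans σz⁻¹ (inverse-∼ cz (∼-sym τz)))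
  paired-pair {τ = τ} cz (inj₂ τz⁻¹) (inj₁ σz) = inj₂ (cτ , ∼-trans σz (∼-sym (inverse-∼ cτ τz⁻¹)))
    where
    cτ : OnCycle τ
    cτ = onCycle-∼ (onCycle-inverse cz) (∼-sym τz⁻¹)
  paired-pair cz (inj₂ τz⁻¹) (inj₂ σz⁻¹) = inj₁ (∼-trans σz⁻¹ (∼-sym τz⁻¹))

  H-cycle : ∀ {τ σ} → τ ⇝* σ → σ ⇝* τ → σ ∼ τ ⊎ (OnCycle τ × σ ∼ (τ ⁻¹ᵘ))
  H-cycle τσ στ with first-cyclic τσ | first-cyclic στ
  ... | inj₂ (z , τz , cz , zσ) | _ = paired-pair cz
        (paired-on-cycle cz (zσ ◅◅ στ) (↣*⇒⇝* τz)) (paired-on-cycle cz zσ (στ ◅◅ ↣*⇒⇝* τz))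
  ... | inj₁ τ↣*σ | inj₂ (z , σz , cz , zτ) = paired-pair cz
        (paired-on-cycle cz zτ (↣*⇒⇝* τ↣*σ ◅◅ ↣*⇒⇝* σz)) (paired-on-cycle cz (zτ ◅◅ τσ) (↣*⇒⇝* σz))
  ... | inj₁ τ↣*σ | inj₁ σ↣*τ = inj₁ (σ↣*τ , τ↣*σ)

-- Each UID τ gets a numeric key, lexicographically composed of
--   • the number of H-predecessors of τ, which strictly grows along H-edges that
--     leave an H-class,
--   • the first position in Σ_UID of the H-class of τ, separating H-classes, and
--   • the first position in Σ_UID of the SCC of τ, separating the (at most two)
--     SCCs of an H-class.
-- Keys identify SCCs, increase along edges of the SCC graph, and no key lies strictly
-- between the keys of an SCC P and of P⁻¹, since these form a single H-class.
module Keys {sch : Schema} (ΣUFD : List (UFD sch)) (ΣUID : List (UID sch))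
  (nonTrivial : All NonTrivialUID ΣUID) (closed : ClosedUnderFinImp ΣUFD ΣUID) where

  open Merged ΣUFD ΣUID nonTrivial closed public
  open Counting
  open Lexicographic (length ΣUID)

  height : UID sch → ℕ
  height τ = count (_⇝*? τ) ΣUID

  H-class-index : UID sch → ℕ
  H-class-index τ = firstIndex (λ ρ → (ρ ⇝*? τ) ×-dec (τ ⇝*? ρ)) ΣUID

  scc-index : UID sch → ℕ
  scc-index τ = firstIndex (λ ρ → (ρ ↣*? τ) ×-dec (τ ↣*? ρ)) ΣUID

  H-key : UID sch → ℕ
  H-key τ = enc (height τ) (H-class-index τ)

  key : UID sch → ℕ
  key τ = enc (H-key τ) (scc-index τ)

  H-class-index-< : ∀ {τ} → τ ∈ ΣUID → H-class-index τ < length ΣUID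
  H-class-index-< τ∈ = firstIndex-< _ ΣUID (lose τ∈ (ε , ε))

  scc-index-< : ∀ {τ} → τ ∈ ΣUID → scc-index τ < length ΣUID
  scc-index-< τ∈ = firstIndex-< _ ΣUID (lose τ∈ (ε , ε))

  H-key-cong : ∀ {τ τ′} → τ ⇝* τ′ → τ′ ⇝* τ → H-key τ ≡ H-key τ′
  H-key-cong ττ′ τ′τ = cong₂ enc
    (≤-antisym (count-mono _ _ ΣUID (λ _ ρτ → ρτ ◅◅ ττ′)) (count-mono _ _ ΣUID (λ _ ρτ′ → ρτ′ ◅◅ τ′τ)))
    (firstIndex-cong _ _ ΣUID (λ _ (ρτ , τρ) → ρτ ◅◅ ττ′ , τ′τ ◅◅ τρ)
                              (λ _ (ρτ′ , τ′ρ) → ρτ′ ◅◅ τ′τ , ττ′ ◅◅ τ′ρ))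

  key-cong : ∀ {τ σ} → τ ∼ σ → key τ ≡ key σ
  key-cong (τσ , στ) = cong₂ enc (H-key-cong (↣*⇒⇝* τσ) (↣*⇒⇝* στ))
    (firstIndex-cong _ _ ΣUID (λ _ (ρτ , τρ) → ρτ ◅◅ τσ , στ ◅◅ τρ)
                              (λ _ (ρσ , σρ) → ρσ ◅◅ στ , τσ ◅◅ σρ))

  key-injective : ∀ {τ σ} → τ ∈ ΣUID → σ ∈ ΣUID → key τ ≡ key σ → τ ∼ σ
  key-injective {τ} {σ} τ∈ σ∈ same
    with firstIndex-common _ _ ΣUID (lose τ∈ (ε , ε)) (lose σ∈ (ε , ε))
           (proj₂ (enc-injective {H-key τ} {H-key σ} (scc-index-< τ∈) (scc-index-< σ∈) same))
  ... | z , (zτ , τz) , (zσ , σz) = τz ◅◅ zσ , σz ◅◅ zτ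

  H-key-injective : ∀ {τ σ} → τ ∈ ΣUID → σ ∈ ΣUID → H-key σ ≡ H-key τ → τ ⇝* σ × σ ⇝* τ
  H-key-injective {τ} {σ} τ∈ σ∈ same
    with firstIndex-common _ _ ΣUID (lose σ∈ (ε , ε)) (lose τ∈ (ε , ε))
           (proj₂ (enc-injective {height σ} {height τ} (H-class-index-< σ∈) (H-class-index-< τ∈) same))
  ... | z , (zσ , σz) , (zτ , τz) = τz ◅◅ zσ , σz ◅◅ zτ

  -- an edge between different SCCs increases the height, hence the key
  key-edge : ∀ {τ σ} → τ ↣ σ → ¬ (τ ∼ σ) → key τ < key σ
  key-edge {τ} {σ} e τ≁σ = enc-<₁ (enc-<₁ height-< (H-class-index-< (↣-∈₁ e))) (scc-index-< (↣-∈₁ e))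
    where
    σ↛τ : ¬ (σ ⇝* τ)
    σ↛τ στ with H-cycle (inj₁ e ◅ ε) στ
    ... | inj₁ σ∼τ = τ≁σ (∼-sym σ∼τ)
    ... | inj₂ (cτ , στ⁻¹ , _) = τ≁σ (e ◅ ε , στ⁻¹ ◅◅ self-inverse cτ (e ◅ στ⁻¹))
    height-< : height τ < height σ
    height-< = count-strict _ _ ΣUID (λ _ ρτ → ρτ ◅◅ (inj₁ e ◅ ε)) (↣-∈₂ e) ε σ↛τ

  Between : UID sch → ℕ → Set
  Between τ k = (key τ < k × k < key (τ ⁻¹ᵘ)) ⊎ (key (τ ⁻¹ᵘ) < k × k < key τ)

  -- τ and τ⁻¹ share their H-key, so a key between theirs has it too, and then its
  -- UID shares their H-class, i.e. lies in the SCC of τ or of τ⁻¹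
  nothing-between : ∀ {τ σ} → OnCycle τ → σ ∈ ΣUID → ¬ Between τ (key σ)
  nothing-between {τ} {σ} cτ σ∈ btw =
    excluded btw (uncurry H-cycle (H-key-injective τ∈ σ∈ (same-H-key btw)))
    where
    τ∈ : τ ∈ ΣUID
    τ∈ = onCycle-∈ cτ
    τ⁻¹∈ : (τ ⁻¹ᵘ) ∈ ΣUID
    τ⁻¹∈ = onCycle-inverse-∈ cτ
    jump-key : H-key (τ ⁻¹ᵘ) ≡ H-key τ
    jump-key = H-key-cong (inj₂ (onCycle-inverse cτ , refl) ◅ ε) (inj₂ (cτ , refl) ◅ ε)
    same-H-key : Between τ (key σ) → H-key σ ≡ H-key τ
    same-H-key (inj₁ (lo , hi)) = enc-between (scc-index-< τ⁻¹∈) (scc-index-< σ∈)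
      lo (subst (λ a → key σ < enc a (scc-index (τ ⁻¹ᵘ))) jump-key hi)
    same-H-key (inj₂ (lo , hi)) = enc-between (scc-index-< τ∈) (scc-index-< σ∈)
      (subst (λ a → enc a (scc-index (τ ⁻¹ᵘ)) < key σ) jump-key lo) hi
    excluded : Between τ (key σ) → σ ∼ τ ⊎ (OnCycle τ × σ ∼ (τ ⁻¹ᵘ)) → ⊥
    excluded (inj₁ (lo , _)) (inj₁ σ∼τ) = <-irrefl (sym (key-cong σ∼τ)) lo
    excluded (inj₂ (_ , hi)) (inj₁ σ∼τ) = <-irrefl (key-cong σ∼τ) hi
    excluded (inj₁ (_ , hi)) (inj₂ (_ , σ∼τ⁻¹)) = <-irrefl (key-cong σ∼τ⁻¹) hi
    excluded (inj₂ (lo , _)) (inj₂ (_ , σ∼τ⁻¹)) = <-irrefl (sym (key-cong σ∼τ⁻¹)) lo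

-- The SCCs are enumerated in the order of their keys: the distinct keys, sorted,
-- index the enumeration, and position i holds the SCC of a UID with the i-th key.
module Enumeration {sch : Schema} (ΣUFD : List (UFD sch)) (ΣUID : List (UID sch))
  (nonTrivial : All NonTrivialUID ΣUID) (closed : ClosedUnderFinImp ΣUFD ΣUID) where

  open Keys ΣUFD ΣUID nonTrivial closed

  SCC : UID sch → UIDSet ΣUFD ΣUID
  SCC τ σ = τ ∼ σ

  SCC-isSCC : ∀ {τ} → τ ∈ ΣUID → IsSCC ΣUFD ΣUID (SCC τ)
  SCC-isSCC τ∈ = ((λ (τσ , _) → ↣*-∈ τ∈ τσ) , (λ (_ , στ) (τσ′ , _) → στ ◅◅ τσ′)) , (_ , ε , ε) ,
    (λ Q (_ , connected) SCC⊆Q σ∈Q → connected (SCC⊆Q (ε , ε)) σ∈Q , connected σ∈Q (SCC⊆Q (ε , ε)))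

  IsSCC⇒SCC : (P : UIDSet ΣUFD ΣUID) → IsSCC ΣUFD ΣUID P → ∃ λ τ → τ ∈ ΣUID × P ≐ SCC τ
  IsSCC⇒SCC P ((P⊆Σ , connected) , (τ , τ∈P) , maximal) =
    τ , P⊆Σ τ∈P , P⊆SCC , maximal (SCC τ) (proj₁ (SCC-isSCC (P⊆Σ τ∈P))) P⊆SCC
    where
    P⊆SCC : ∀ {σ} → P σ → SCC τ σ
    P⊆SCC σ∈P = connected τ∈P σ∈P , connected σ∈P τ∈P

  SCC-≐ : ∀ {τ σ} → τ ∼ σ → SCC τ ≐ SCC σ
  SCC-≐ (τσ , στ) = (λ (τρ , ρτ) → στ ◅◅ τρ , ρτ ◅◅ τσ) , (λ (σρ , ρσ) → τσ ◅◅ σρ , ρσ ◅◅ στ)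

  IsKey : ℕ → Set
  IsKey k = Any (λ τ → key τ ≡ k) ΣUID

  -- opaque: the list of keys is only used through the three facts below
  opaque
    isKey? : ∀ k → Dec (IsKey k)
    isKey? k = any? (λ τ → key τ ℕ.≟ k) ΣUID

    keys : List ℕ
    keys = filter isKey? (upTo (suc (max 0 (map key ΣUID))))

    keys-increasing : AllPairs _<_ keys
    keys-increasing = AllPairs.filter⁺ isKey? (AllPairs.applyUpTo⁺₁ id _ (λ i<j _ → i<j))

    key∈keys : ∀ {τ} → τ ∈ ΣUID → key τ ∈ keys
    key∈keys {τ} τ∈ = ∈-filter⁺ isKey?
      (∈-upTo⁺ (s≤s (All.lookup (xs≤max 0 (map key ΣUID)) (∈-map⁺ key τ∈)))) (lose τ∈ refl)

    keys-are-keys : ∀ {k} → k ∈ keys → IsKey k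
    keys-are-keys = proj₂ ∘ ∈-filter⁻ isKey?

  position : ∀ {τ} → τ ∈ ΣUID → ∃ λ i → lookup keys i ≡ key τ
  position τ∈ = index (key∈keys τ∈) , sym (lookup-index (key∈keys τ∈))

  representative : (i : Fin (length keys)) → ∃ λ τ → τ ∈ ΣUID × key τ ≡ lookup keys i
  representative i = find (keys-are-keys (∈-lookup i))

  rep : Fin (length keys) → UID sch
  rep i = proj₁ (representative i)

  rep-∈ : ∀ i → rep i ∈ ΣUID
  rep-∈ i = proj₁ (proj₂ (representative i))

  rep-key : ∀ i → key (rep i) ≡ lookup keys i
  rep-key i = proj₂ (proj₂ (representative i))

  open Increasing keys-increasing

  enumeration : Fin (length keys) → UIDSet ΣUFD ΣUID
  enumeration i = SCC (rep i)

  complete : (P : UIDSet ΣUFD ΣUID) → IsSCC ΣUFD ΣUID P → ∃ λ i → enumeration i ≐ P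
  complete P P-scc = from-representative (IsSCC⇒SCC P P-scc)
    where
    from-representative : (∃ λ τ → τ ∈ ΣUID × P ≐ SCC τ) → ∃ λ i → enumeration i ≐ P
    from-representative (τ , τ∈ , P⊆SCC , SCC⊆P) =
      i , (λ σ∈i → SCC⊆P (proj₁ i≐τ σ∈i)) , (λ σ∈P → proj₂ i≐τ (P⊆SCC σ∈P))
      where
      i : Fin (length keys)
      i = proj₁ (position τ∈)
      i≐τ : SCC (rep i) ≐ SCC τ
      i≐τ = SCC-≐ (key-injective (rep-∈ i) τ∈ (trans (rep-key i) (proj₂ (position τ∈))))

  distinct : ∀ i j → enumeration i ≐ enumeration j → i ≡ j
  distinct i j (i⊆j , _) = lookup-injective i j
    (trans (sym (rep-key i)) (trans (key-cong (∼-sym (i⊆j (ε , ε)))) (rep-key j)))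

  ordered : ∀ i j → SCCEdge ΣUFD ΣUID (enumeration i) (enumeration j) → toℕ i < toℕ j
  ordered i j (different , τ , τ′ , τ∈i , τ′∈j , e) = lookup-<⁻ i j
    (subst₂ _<_ (trans (sym (key-cong τ∈i)) (rep-key i)) (trans (key-cong (∼-sym τ′∈j)) (rep-key j))
            (key-edge e τ≁τ′))
    where
    τ≁τ′ : ¬ (τ ∼ τ′)
    τ≁τ′ ττ′ = different (SCC-≐ (∼-trans τ∈i (∼-trans ττ′ (∼-sym τ′∈j))))

  topologicalSort : TopologicalSort ΣUFD ΣUID
  topologicalSort = record
    { n = length keys ; L = enumeration ; isSCC = λ i → SCC-isSCC (rep-∈ i)
    ; complete = complete ; distinct = distinct ; ordered = ordered }

  cyclic-if-nontrivial : ∀ τ → ¬ TrivialSCC ΣUFD ΣUID (SCC τ) → OnCycle τ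
  cyclic-if-nontrivial τ nontrivial with onCycle? τ
  ... | yes c = c
  ... | no ¬c = ⊥-elim (nontrivial (τ , (singleton , λ { refl → ε , ε }) , λ e → ¬c (τ , e , ε)))
    where
    singleton : ∀ {σ} → SCC τ σ → σ ≡ τ
    singleton (ε , _) = refl
    singleton (e ◅ τσ , στ) = ⊥-elim (¬c (_ , e , τσ ◅◅ στ))

  adjacent : ∀ i j → OnCycle (rep i) → ¬ (rep i ∼ (rep i ⁻¹ᵘ)) → lookup keys j ≡ key (rep i ⁻¹ᵘ) →
    toℕ j ≡ suc (toℕ i) ⊎ toℕ i ≡ suc (toℕ j)
  adjacent i j c differ j-key with <-cmp (lookup keys i) (lookup keys j)
  ... | tri≈ _ same _ =
    ⊥-elim (differ (key-injective (rep-∈ i) (onCycle-inverse-∈ c) (trans (rep-key i) (trans same j-key))))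
  ... | tri< lt _ _ = inj₁ (lookup-adjacent i j lt λ m lo hi → nothing-between c (rep-∈ m)
    (inj₁ (subst₂ _<_ (sym (rep-key i)) (sym (rep-key m)) lo , subst₂ _<_ (sym (rep-key m)) j-key hi)))
  ... | tri> _ _ gt = inj₂ (lookup-adjacent j i gt λ m lo hi → nothing-between c (rep-∈ m)
    (inj₂ (subst₂ _<_ j-key (sym (rep-key m)) lo , subst₂ _<_ (sym (rep-key m)) (sym (rep-key i)) hi)))

  inverseSequential : InverseSequential ΣUFD ΣUID topologicalSort
  inverseSequential i (nontrivial , not-self-inverse) =
    j , adjacent i j c differ (proj₂ (position (onCycle-inverse-∈ c))) ,
    (λ σ∈j → inverse-∼ (onCycle-inverse c) (∼-trans (∼-sym j∼τ⁻¹) σ∈j)) ,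
    (λ σ⁻¹∈i → ∼-trans j∼τ⁻¹ (inverse-∼ c σ⁻¹∈i))
    where
    τ : UID sch
    τ = rep i
    c : OnCycle τ
    c = cyclic-if-nontrivial τ nontrivial
    j : Fin (length keys)
    j = proj₁ (position (onCycle-inverse-∈ c))
    j∼τ⁻¹ : rep j ∼ (τ ⁻¹ᵘ)
    j∼τ⁻¹ = key-injective (rep-∈ j) (onCycle-inverse-∈ c)
      (trans (rep-key j) (proj₂ (position (onCycle-inverse-∈ c))))
    differ : ¬ (τ ∼ (τ ⁻¹ᵘ))
    differ ττ⁻¹ = not-self-inverse ((λ τσ → ∼-trans ττ⁻¹ (inverse-∼ c τσ)) ,
                                    (λ τσ⁻¹ → ∼-trans ττ⁻¹ (inverse-∼ c τσ⁻¹)))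

mainTheorem16 : (sch : Schema) (ΣUFD : List (UFD sch)) (ΣUID : List (UID sch)) →
    All NonTrivialUID ΣUID →
    ClosedUnderFinImp ΣUFD ΣUID →
    Σ (TopologicalSort ΣUFD ΣUID) (InverseSequential ΣUFD ΣUID)
mainTheorem16 sch ΣUFD ΣUID nonTrivial closed = topologicalSort , inverseSequential
  where open Enumeration ΣUFD ΣUID nonTrivial closed
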